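{- Let $a$ be a positive integer with binary expansion $a=\sum_{k=0}^N a_k2^k$, $a_N=1$, $\underline a=a_0\cdots a_N$. For $j\in\{0,\dots,N\}$ let $b^1_j$ be the length of the maximal run of consecutive digits equal to $a_j$ ending at position $j$ and extending towards lower indices (i.e. $b^1_j=j-i+1$ where $i$ is the least index with $a_i=\cdots=a_j$). Then $$l(a)\le\sum_{j=0}^N\frac{1}{2^{b^1_j}}\le 2\,l(a)+1.$$
   Context: $l(a)$ is the number of occurrences of the subword $01$ in $\underline a$, i.e. the number of indices $i$ with $a_i=0$, $a_{i+1}=1$. -}

module Defs where

open import Data.Nat using (ℕ; zero; suc; _^_; _%_; _/_; _≡ᵇ_)
open import Data.Bool using (Bool; true; false; if_then_else_)
open import Data.Bool.Properties using () renaming (_≟_ to _≟ᵇ_)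
open import Data.List using (List; []; _∷_; sum; map)
open import Relation.Nullary using (yes; no)
open import Data.Rational using (ℚ; 0ℚ)
import Data.Rational as Q
open import Data.Integer using (+_)
open import Data.Nat.Properties using (m^n≢0)
open import Data.Rational using (_≤_)



bitsF : ℕ → ℕ → List Bool
bitsF zero    _ = []
bitsF (suc f) zero = []
bitsF (suc f) (suc n) = (suc n % 2 ≡ᵇ 1) ∷ bitsF f (suc n / 2)

-- digits a₀ a₁ … a_N of a (for a > 0, a_N = true); true = digit 1
bits : ℕ → List Bool
bits a = bitsF a a

count01 : List Bool → ℕ
count01 []                  = 0
count01 (false ∷ true ∷ xs) = suc (count01 (true ∷ xs))
count01 (_ ∷ xs)            = count01 xs

l : ℕ → ℕ
l a = count01 (bits a)

runsFrom : Bool → ℕ → List Bool → List ℕ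
runsFrom prev r [] = []
runsFrom prev r (x ∷ xs) with x ≟ᵇ prev
... | yes _ = suc r ∷ runsFrom x (suc r) xs
... | no  _ = 1 ∷ runsFrom x 1 xs

runs : List Bool → List ℕ
runs []       = []
runs (x ∷ xs) = 1 ∷ runsFrom x 1 xs

b1 : ℕ → List ℕ
b1 a = runs (bits a)

sumQ : List ℚ → ℚ
sumQ []       = 0ℚ
sumQ (q ∷ qs) = q Q.+ sumQ qs

invPow2 : ℕ → ℚ
invPow2 b = (+ 1) Q./ (2 ^ b)
  where instance _ = m^n≢0 2 b

S : ℕ → ℚ
S a = sumQ (map invPow2 (b1 a))

module Submission where

-- Cut the binary word a₀ ⋯ a_N into its maximal runs of equal
-- digits.  Inside a run of length m the run lengths b¹_j are 1, 2, …, m, so the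
-- run contributes 1/2 + ⋯ + 1/2^m, a number in [1/2, 1).  Hence, if R is the
-- number of runs, R/2 ≤ Σ_j 2^{-b¹_j} ≤ R.  The runs alternate in digit and the
-- last one consists of 1s, so every run of 0s is followed by a run of 1s and
-- l(a) counts exactly the runs of 0s; therefore R = 2 l(a) + a₀, i.e.
-- 2 l(a) ≤ R ≤ 2 l(a) + 1, and both inequalities of the theorem follow.

open import Defs
open import Data.Nat using (ℕ; _>_)
open import Data.Integer using (+_)
open import Data.Product using (_×_)
open import Data.Rational using (_≤_; _+_; _*_; _/_; 1ℚ)

open import Data.Nat as ℕ using (zero; suc; _^_; s≤s; z≤n)
import Data.Nat.Properties as ℕP
open import Data.Nat.DivMod using (m/n≡1+[m∸n]/n; m/n≤m)
open import Data.Nat.Tactic.RingSolver using (solve)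
open import Data.Bool using (Bool; true; false)
open import Data.Bool.Properties using () renaming (_≟_ to _≟ᵇ_)
open import Data.List using (List; []; _∷_; map)
open import Data.Product using (_,_)
open import Data.Empty using (⊥)
open import Function using (_∘_)
open import Relation.Nullary using (yes; no)
open import Relation.Binary.PropositionalEquality
open import Data.Rational using (ℚ; 0ℚ; ½; toℚᵘ)
import Data.Rational.Properties as ℚP
open import Data.Rational.Solver using (module +-*-Solver)
open import Data.Rational.Unnormalised as ℚᵘ using (*≡*; 1ℚᵘ)
import Data.Rational.Unnormalised.Properties as ℚᵘP

lastOf : Bool → List Bool → Bool
lastOf x []       = x
lastOf x (y ∷ ys) = lastOf y ys

EndsWithOne : List Bool → Set
EndsWithOne []       = ⊥
EndsWithOne (x ∷ xs) = lastOf x xs ≡ true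

lastOf-nonEmpty : ∀ x ys → EndsWithOne ys → lastOf x ys ≡ true
lastOf-nonEmpty x (y ∷ ys) e = e

bitsF-endsWithOne : ∀ f n → suc n ℕ.≤ f → EndsWithOne (bitsF f (suc n))
bitsF-endsWithOne (suc zero)    zero    _         = refl
bitsF-endsWithOne (suc (suc f)) zero    _         = refl
bitsF-endsWithOne (suc f)       (suc m) (s≤s m<f) =
  lastOf-nonEmpty _ (bitsF f (suc (suc m) ℕ./ 2))
    (subst (λ k → EndsWithOne (bitsF f k)) (sym halve)
      (bitsF-endsWithOne f (m ℕ./ 2) (ℕP.≤-trans (s≤s (m/n≤m m 2)) m<f)))
  where
  halve : suc (suc m) ℕ./ 2 ≡ suc (m ℕ./ 2)
  halve = m/n≡1+[m∸n]/n {suc (suc m)} {2} (s≤s (s≤s z≤n))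

bits-endsWithOne : ∀ n → EndsWithOne (bits (suc n))
bits-endsWithOne n = bitsF-endsWithOne (suc n) n ℕP.≤-refl

changes : Bool → List Bool → ℕ
changes p [] = 0
changes p (x ∷ xs) with x ≟ᵇ p
... | yes _ = changes x xs
... | no  _ = suc (changes x xs)

runCount : List Bool → ℕ
runCount []       = 0
runCount (x ∷ xs) = suc (changes x xs)

-- In a word ending with 1 the changes pair up as 0→1 after 1→0, so the number
-- of changes is 2 l if the word starts with 1 and 2 l − 1 if it starts with 0.
mutual
  changes-fromOne : ∀ xs → lastOf true xs ≡ true →
                    changes true xs ≡ count01 xs ℕ.+ count01 xs
  changes-fromOne []           _ = refl
  changes-fromOne (true ∷ ys)  e = changes-fromOne ys e
  changes-fromOne (false ∷ ys) e = changes-fromZero ys e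

  changes-fromZero : ∀ xs → lastOf false xs ≡ true →
                     suc (changes false xs) ≡ count01 (false ∷ xs) ℕ.+ count01 (false ∷ xs)
  changes-fromZero (false ∷ ys) e = changes-fromZero ys e
  changes-fromZero (true ∷ ys)  e = begin
    suc (suc (changes true ys))  ≡⟨ cong (suc ∘ suc) (changes-fromOne ys e) ⟩
    suc (suc (c ℕ.+ c))          ≡⟨ cong suc (ℕP.+-suc c c) ⟨
    suc c ℕ.+ suc c              ∎
    where
    open ≡-Reasoning
    c = count01 ys

runCount-bounds : ∀ ws → EndsWithOne ws →
  (count01 ws ℕ.+ count01 ws ℕ.≤ runCount ws) × (runCount ws ℕ.≤ suc (count01 ws ℕ.+ count01 ws))
runCount-bounds (true ∷ xs) e rewrite changes-fromOne xs e = ℕP.n≤1+n _ , ℕP.≤-refl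
runCount-bounds (false ∷ xs) e rewrite changes-fromZero xs e = ℕP.≤-refl , ℕP.n≤1+n _

⟦_⟧ : ℕ → ℚ
⟦ n ⟧ = + n / 1

-- i / n computed in ℚ agrees with i / n computed in ℚᵘ; identities in ℚ are
-- proved by mapping them injectively into ℚᵘ, where they are plain arithmetic
toℚᵘ-/ : ∀ i n .{{_ : ℕ.NonZero n}} → toℚᵘ (i / n) ℚᵘ.≃ i ℚᵘ./ n
toℚᵘ-/ i (suc k) = ℚP.toℚᵘ-fromℚᵘ (ℚᵘ.mkℚᵘ i k)

unitFraction-halve : ∀ d .{{_ : ℕ.NonZero d}} →
  (+ 1 ℚᵘ./ (2 ℕ.* d)) {{ℕP.m*n≢0 2 d}} ℚᵘ.+ (+ 1 ℚᵘ./ (2 ℕ.* d)) {{ℕP.m*n≢0 2 d}}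
    ℚᵘ.≃ + 1 ℚᵘ./ d
unitFraction-halve (suc k) = *≡* (cong +_ (solve (k ∷ [])))

-- 1/2^{r+1} + 1/2^{r+1} = 1/2^r: the contributions of a run telescope
invPow2-halve : ∀ r → invPow2 (suc r) + invPow2 (suc r) ≡ invPow2 r
invPow2-halve r = ℚP.toℚᵘ-injective (begin
  toℚᵘ (h′ + h′)                ≈⟨ ℚP.toℚᵘ-homo-+ h′ h′ ⟩
  toℚᵘ h′ ℚᵘ.+ toℚᵘ h′          ≈⟨ ℚᵘP.+-cong h′≃ h′≃ ⟩
  u′ ℚᵘ.+ u′                    ≈⟨ unitFraction-halve (2 ^ r) {{2^r≢0}} ⟩
  (+ 1 ℚᵘ./ 2 ^ r) {{2^r≢0}}    ≈⟨ toℚᵘ-/ (+ 1) (2 ^ r) {{2^r≢0}} ⟨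
  toℚᵘ (invPow2 r)              ∎)
  where
  open ℚᵘP.≃-Reasoning
  2^r≢0 = ℕP.m^n≢0 2 r
  h′ = invPow2 (suc r)
  u′ = (+ 1 ℚᵘ./ 2 ^ suc r) {{ℕP.m^n≢0 2 (suc r)}}
  h′≃ : toℚᵘ h′ ℚᵘ.≃ u′
  h′≃ = toℚᵘ-/ (+ 1) (2 ^ suc r) {{ℕP.m^n≢0 2 (suc r)}}

invPow2-nonNeg : ∀ r → 0ℚ ≤ invPow2 r
invPow2-nonNeg r = ℚP.nonNegative⁻¹ (invPow2 r) {{ℚP.normalize-nonNeg 1 (2 ^ r) {{ℕP.m^n≢0 2 r}}}}

⟦⟧-nonNeg : ∀ n → 0ℚ ≤ ⟦ n ⟧
⟦⟧-nonNeg n = ℚP.nonNegative⁻¹ ⟦ n ⟧ {{ℚP.normalize-nonNeg n 1}}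

⟦⟧-suc : ∀ n → ⟦ suc n ⟧ ≡ 1ℚ + ⟦ n ⟧
⟦⟧-suc n = ℚP.toℚᵘ-injective (begin
  toℚᵘ ⟦ suc n ⟧             ≈⟨ toℚᵘ-/ (+ suc n) 1 ⟩
  + suc n ℚᵘ./ 1             ≈⟨ oneMore n ⟩
  1ℚᵘ ℚᵘ.+ + n ℚᵘ./ 1        ≈⟨ ℚᵘP.+-congʳ 1ℚᵘ (toℚᵘ-/ (+ n) 1) ⟨
  toℚᵘ 1ℚ ℚᵘ.+ toℚᵘ ⟦ n ⟧    ≈⟨ ℚP.toℚᵘ-homo-+ 1ℚ ⟦ n ⟧ ⟨
  toℚᵘ (1ℚ + ⟦ n ⟧)          ∎)
  where
  open ℚᵘP.≃-Reasoning
  oneMore : ∀ m → + suc m ℚᵘ./ 1 ℚᵘ.≃ 1ℚᵘ ℚᵘ.+ + m ℚᵘ./ 1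
  oneMore zero    = *≡* refl
  oneMore (suc m) = *≡* (cong +_ (solve (m ∷ [])))

⟦⟧-+ : ∀ m n → ⟦ m ℕ.+ n ⟧ ≡ ⟦ m ⟧ + ⟦ n ⟧
⟦⟧-+ zero    n = sym (ℚP.+-identityˡ ⟦ n ⟧)
⟦⟧-+ (suc m) n = begin
  ⟦ suc (m ℕ.+ n) ⟧          ≡⟨ ⟦⟧-suc (m ℕ.+ n) ⟩
  1ℚ + ⟦ m ℕ.+ n ⟧           ≡⟨ cong (λ q → 1ℚ + q) (⟦⟧-+ m n) ⟩
  1ℚ + (⟦ m ⟧ + ⟦ n ⟧)       ≡⟨ ℚP.+-assoc 1ℚ ⟦ m ⟧ ⟦ n ⟧ ⟨
  (1ℚ + ⟦ m ⟧) + ⟦ n ⟧       ≡⟨ cong (_+ ⟦ n ⟧) (⟦⟧-suc m) ⟨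
  ⟦ suc m ⟧ + ⟦ n ⟧          ∎
  where open ≡-Reasoning

⟦⟧-mono : ∀ {m n} → m ℕ.≤ n → ⟦ m ⟧ ≤ ⟦ n ⟧
⟦⟧-mono {n = n} z≤n = ⟦⟧-nonNeg n
⟦⟧-mono {suc m} {suc n} (s≤s m≤n)
  rewrite ⟦⟧-suc m | ⟦⟧-suc n = ℚP.+-monoʳ-≤ 1ℚ (⟦⟧-mono m≤n)

≤-+-nonNeg : ∀ {p} q → 0ℚ ≤ q → p ≤ q + p
≤-+-nonNeg {p} q 0≤q = subst (_≤ q + p) (ℚP.+-identityˡ p) (ℚP.+-monoˡ-≤ p 0≤q)

-- ½ + ½ = 1: a run of length ≥ 1 together with its remaining capacity 2^{-1}
½+½+ : ∀ q → ½ + (½ + q) ≡ 1ℚ + q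
½+½+ q = sym (ℚP.+-assoc ½ ½ q)

½*⟦suc⟧ : ∀ n → ½ * ⟦ suc n ⟧ ≡ ½ + ½ * ⟦ n ⟧
½*⟦suc⟧ n = trans (cong (λ q → ½ * q) (⟦⟧-suc n)) (ℚP.*-distribˡ-+ ½ 1ℚ ⟦ n ⟧)

½*double : ∀ q → ½ * (q + q) ≡ q
½*double = +-*-Solver.solve 1 (λ q → con ½ :* (q :+ q) := q) refl
  where open +-*-Solver using (con; _:+_; _:*_; _:=_)

two* : ∀ q → (+ 2) / 1 * q ≡ q + q
two* = +-*-Solver.solve 1 (λ q → con ((+ 2) / 1) :* q := q :+ q) refl
  where open +-*-Solver using (con; _:+_; _:*_; _:=_)

-- contribution Σ 2^{-b} of the letters xs following a letter p that ends a run
-- of length r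
runTail : Bool → ℕ → List Bool → ℚ
runTail p r xs = sumQ (map invPow2 (runsFrom p r xs))

digitSum : List Bool → ℚ
digitSum ws = sumQ (map invPow2 (runs ws))

-- Upper bound: the current run can add at most 2^{-r} in total (the terms
-- 2^{-(r+1)} + 2^{-(r+2)} + ⋯ telescope), and every later run at most 1.
mutual
  runTail-upper : ∀ p r xs → runTail p r xs ≤ invPow2 r + ⟦ changes p xs ⟧
  runTail-upper p r [] = ≤-+-nonNeg (invPow2 r) (invPow2-nonNeg r)
  runTail-upper p r (x ∷ xs) with x ≟ᵇ p
  ... | yes refl = begin
    h + runTail x (suc r) xs    ≤⟨ ℚP.+-monoʳ-≤ h (runTail-upper x (suc r) xs) ⟩
    h + (h + ⟦ c ⟧)             ≡⟨ ℚP.+-assoc h h ⟦ c ⟧ ⟨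
    (h + h) + ⟦ c ⟧             ≡⟨ cong (_+ ⟦ c ⟧) (invPow2-halve r) ⟩
    invPow2 r + ⟦ c ⟧           ∎
    where
    open ℚP.≤-Reasoning
    h = invPow2 (suc r)
    c = changes x xs
  ... | no _ = begin
    ½ + runTail x 1 xs          ≤⟨ newRun-upper x xs ⟩
    ⟦ suc (changes x xs) ⟧      ≤⟨ ≤-+-nonNeg (invPow2 r) (invPow2-nonNeg r) ⟩
    invPow2 r + ⟦ suc (changes x xs) ⟧ ∎
    where open ℚP.≤-Reasoning

  newRun-upper : ∀ x xs → ½ + runTail x 1 xs ≤ ⟦ suc (changes x xs) ⟧
  newRun-upper x xs = begin
    ½ + runTail x 1 xs          ≤⟨ ℚP.+-monoʳ-≤ ½ (runTail-upper x 1 xs) ⟩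
    ½ + (½ + ⟦ changes x xs ⟧)  ≡⟨ ½+½+ ⟦ changes x xs ⟧ ⟩
    1ℚ + ⟦ changes x xs ⟧       ≡⟨ ⟦⟧-suc (changes x xs) ⟨
    ⟦ suc (changes x xs) ⟧      ∎
    where open ℚP.≤-Reasoning

-- Lower bound: every run after the current one contributes at least the 1/2
-- of its first letter.
mutual
  runTail-lower : ∀ p r xs → ½ * ⟦ changes p xs ⟧ ≤ runTail p r xs
  runTail-lower p r [] = ℚP.≤-refl
  runTail-lower p r (x ∷ xs) with x ≟ᵇ p
  ... | yes refl = ℚP.≤-trans (runTail-lower x (suc r) xs)
                     (≤-+-nonNeg (invPow2 (suc r)) (invPow2-nonNeg (suc r)))
  ... | no _ = newRun-lower x xs

  newRun-lower : ∀ x xs → ½ * ⟦ suc (changes x xs) ⟧ ≤ ½ + runTail x 1 xs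
  newRun-lower x xs = begin
    ½ * ⟦ suc (changes x xs) ⟧  ≡⟨ ½*⟦suc⟧ (changes x xs) ⟩
    ½ + ½ * ⟦ changes x xs ⟧    ≤⟨ ℚP.+-monoʳ-≤ ½ (runTail-lower x 1 xs) ⟩
    ½ + runTail x 1 xs          ∎
    where open ℚP.≤-Reasoning

digitSum-bounds : ∀ ws → (½ * ⟦ runCount ws ⟧ ≤ digitSum ws) × (digitSum ws ≤ ⟦ runCount ws ⟧)
digitSum-bounds []       = ℚP.≤-refl , ℚP.≤-refl
digitSum-bounds (x ∷ xs) = newRun-lower x xs , newRun-upper x xs

word-bounds : ∀ ws → EndsWithOne ws →
  (⟦ count01 ws ⟧ ≤ digitSum ws) × (digitSum ws ≤ (+ 2) / 1 * ⟦ count01 ws ⟧ + 1ℚ)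
word-bounds ws e with runCount-bounds ws e | digitSum-bounds ws
... | 2l≤R , R≤2l+1 | ½R≤Σ , Σ≤R = lower , upper
  where
  open ℚP.≤-Reasoning
  c = count01 ws
  lower : ⟦ c ⟧ ≤ digitSum ws
  lower = begin
    ⟦ c ⟧                      ≡⟨ ½*double ⟦ c ⟧ ⟨
    ½ * (⟦ c ⟧ + ⟦ c ⟧)        ≡⟨ cong (λ q → ½ * q) (⟦⟧-+ c c) ⟨
    ½ * ⟦ c ℕ.+ c ⟧            ≤⟨ ℚP.*-monoˡ-≤-nonNeg ½ (⟦⟧-mono 2l≤R) ⟩
    ½ * ⟦ runCount ws ⟧        ≤⟨ ½R≤Σ ⟩
    digitSum ws                ∎
  upper : digitSum ws ≤ (+ 2) / 1 * ⟦ c ⟧ + 1ℚ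
  upper = begin
    digitSum ws                ≤⟨ Σ≤R ⟩
    ⟦ runCount ws ⟧            ≤⟨ ⟦⟧-mono R≤2l+1 ⟩
    ⟦ suc (c ℕ.+ c) ⟧          ≡⟨ ⟦⟧-suc (c ℕ.+ c) ⟩
    1ℚ + ⟦ c ℕ.+ c ⟧           ≡⟨ ℚP.+-comm 1ℚ ⟦ c ℕ.+ c ⟧ ⟩
    ⟦ c ℕ.+ c ⟧ + 1ℚ           ≡⟨ cong (_+ 1ℚ) (⟦⟧-+ c c) ⟩
    (⟦ c ⟧ + ⟦ c ⟧) + 1ℚ       ≡⟨ cong (_+ 1ℚ) (two* ⟦ c ⟧) ⟨
    (+ 2) / 1 * ⟦ c ⟧ + 1ℚ     ∎

lemma10 : (a : ℕ) → a > 0 →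
    ((+ l a) / 1 ≤ S a) × (S a ≤ (+ 2) / 1 * ((+ l a) / 1) + 1ℚ)
lemma10 (suc n) _ = word-bounds (bits (suc n)) (bits-endsWithOne n)
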